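{- For any positive integers $m$, $n$ and $r$, \[\mathbb{E}_{\mathfrak{S}_{n,r}}[X_1X_2\cdots X_n]=\mathbb{E}_{\mathfrak{S}_{m+n,r}}[X_{m+1}X_{m+2}\cdots X_{m+n}].\]
   Context: For a positive integer $N$, $\mathfrak{S}_{N,r}$ is the set of pairs $(\omega,\tau)$, $\omega\in\mathfrak{S}_N$, $\tau:[N]\to\mathbb{Z}_r$ (colors $0,\ldots,r-1$). Order symbols $i^c$ by $1^0<\cdots<N^0<1^1<\cdots<N^1<\cdots<1^{r-1}<\cdots<N^{r-1}$. An index $i\in[N]$ is a descent of $(\omega,\tau)$ if $\omega(i)^{\tau(i)}>\omega(i+1)^{\tau(i+1)}$, with the convention $\omega(N+1)=N+1$, $\tau(N+1)=0$. $X_i$ is the indicator (on the relevant group) that $i$ is a descent. Expectations are with respect to the uniform distribution. -}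

module Defs where

open import Data.Nat using (ℕ; zero; suc; _+_; _*_; _<ᵇ_; _≡ᵇ_)
open import Data.Bool using (Bool; true; false; _∧_; _∨_; not)
open import Data.Fin using (Fin; toℕ; fromℕ<)
open import Data.Fin.Properties using (_≟_)
open import Data.List using (List; []; _∷_; [_]; map; concatMap; allFin; length; filterᵇ; upTo)
open import Data.Product using (_×_; _,_; proj₁; proj₂)
open import Data.Vec.Functional using () renaming (_∷_ to _∷ᶠ_)
open import Relation.Nullary.Decidable using (⌊_⌋)
open import Data.Nat.Properties using (_<?_)
open import Relation.Nullary using (yes; no)

allᵇ : {A : Set} → (A → Bool) → List A → Bool
allᵇ p []       = true
allᵇ p (x ∷ xs) = p x ∧ allᵇ p xs

allFuns : (N k : ℕ) → List (Fin N → Fin k)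
allFuns zero    k = [ (λ ()) ]
allFuns (suc N) k = concatMap (λ f → map (λ i → i ∷ᶠ f) (allFin k)) (allFuns N k)

-- ω : Fin N → Fin N is a permutation iff injective (finite set).
isInjᵇ : {N : ℕ} → (Fin N → Fin N) → Bool
isInjᵇ {N} ω = allᵇ (λ i → allᵇ (λ j → not ⌊ ω i ≟ ω j ⌋ ∨ ⌊ i ≟ j ⌋) (allFin N)) (allFin N)

perms : (N : ℕ) → List (Fin N → Fin N)
perms N = filterᵇ isInjᵇ (allFuns N N)

-- 𝔖_{N,r} : pairs (ω , τ), ω a permutation, τ a colouring [N] → ℤ_r.
ColPerm : ℕ → ℕ → Set
ColPerm N r = (Fin N → Fin N) × (Fin N → Fin r)

colPerms : (N r : ℕ) → List (ColPerm N r)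
colPerms N r = concatMap (λ ω → map (λ τ → ω , τ) (allFuns N r)) (perms N)

-- Value (0-based) at 0-based position p; sentinel position N has value N
-- (i.e. the 1-based value N+1).
valAt : {N : ℕ} → (Fin N → Fin N) → ℕ → ℕ
valAt {N} ω p with p <? N
... | yes p<N = toℕ (ω (fromℕ< p<N))
... | no  _   = N

-- Colour at 0-based position p; sentinel position N has colour 0.
colAt : {N r : ℕ} → (Fin N → Fin r) → ℕ → ℕ
colAt {N} τ p with p <? N
... | yes p<N = toℕ (τ (fromℕ< p<N))
... | no  _   = 0

-- i^c < j^d  iff  c < d, or c = d and i < j.
-- Descent at 0-based position p (i.e. 1-based index p+1):
-- ω(p+1)^{τ(p+1)} > ω(p+2)^{τ(p+2)} in 1-based terms.
isDescentᵇ : {N r : ℕ} → ColPerm N r → ℕ → Bool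
isDescentᵇ (ω , τ) p =
  (colAt τ (suc p) <ᵇ colAt τ p)
  ∨ ((colAt τ p ≡ᵇ colAt τ (suc p)) ∧ (valAt ω (suc p) <ᵇ valAt ω p))

-- Number of elements of 𝔖_{N,r} for which all (0-based) positions in S are descents,
-- i.e. the sum over 𝔖_{N,r} of the product of the X_i, i ∈ S.
countAllDesc : (N r : ℕ) → List ℕ → ℕ
countAllDesc N r S = length (filterᵇ (λ x → allᵇ (isDescentᵇ x) S) (colPerms N r))

size : (N r : ℕ) → ℕ
size N r = length (colPerms N r)

-- Every coloured permutation of [N + 1] is uniquely its first letter i^c followed by a
-- coloured permutation of [N] whose values are shifted up past i (punchIn i).  The shift
-- preserves the relative order of the remaining letters and of the sentinel N + 1, so a
-- descent at position p + 1 of the whole is a descent at position p of the tail.  Stripping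
-- the first letter m times therefore shows that both |𝔖_{m+n,r}| and the number of elements
-- of 𝔖_{m+n,r} with descents at m + 1, …, m + n are (m + n)!/n! · r^m times their
-- counterparts in 𝔖_{n,r} (with descents at 1, …, n), so the two expectations agree.
module Submission where

open import Defs
open import Algebra.Bundles using (CommutativeMonoid)
open import Data.Bool using (Bool; true; false; _∧_; _∨_; not)
open import Data.Bool.Properties using (∧-assoc; ∧-comm; ∧-idem; ∨-identityʳ; ∨-zeroʳ; ∧-commutativeMonoid)
open import Data.Empty using (⊥-elim)
open import Data.Fin using (Fin; zero; suc; toℕ; fromℕ<; punchIn)
open import Data.Fin.Properties using (_≟_; suc-injective; punchIn-injective; toℕ<n)
open import Data.List using (List; []; _∷_; _++_; map; concatMap; allFin; upTo; length; filterᵇ)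
open import Data.List.Properties using (map-tabulate; length-tabulate)
open import Data.Nat using (ℕ; zero; suc; _+_; _*_; _<_; _≤_; _≥_; _<ᵇ_; z≤n; s≤s)
open import Data.Nat.Properties
  using (_<?_; +-assoc; +-identityʳ; *-identityʳ; *-identityˡ; *-zeroʳ; *-assoc; *-comm; *-distribˡ-+; ≤-pred; +-commutativeSemigroup)
open import Data.Product using (_,_)
open import Data.Vec.Functional using () renaming (_∷_ to _∷ᶠ_)
open import Function using (_∘_; id; case_of_; _⇔_; mk⇔)
open import Relation.Binary.PropositionalEquality using (_≡_; refl; sym; trans; cong; cong₂; _≗_; module ≡-Reasoning)
open import Relation.Nullary using (Dec; yes; no; ¬_)
open import Relation.Nullary.Decidable using (⌊_⌋; isYes≗does; does-⇔)

open import Algebra.Properties.CommutativeSemigroup +-commutativeSemigroup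
  using () renaming (interchange to +-interchange)
open import Algebra.Properties.CommutativeSemigroup
  (CommutativeMonoid.commutativeSemigroup ∧-commutativeMonoid)
  using () renaming (interchange to ∧-interchange)

private
  variable
    A B : Set

⟦_⟧ : Bool → ℕ
⟦ true ⟧  = 1
⟦ false ⟧ = 0

⟦∧⟧-* : (a b : Bool) (x : ℕ) → ⟦ a ∧ b ⟧ * x ≡ ⟦ a ⟧ * (⟦ b ⟧ * x)
⟦∧⟧-* true  b x = sym (+-identityʳ (⟦ b ⟧ * x))
⟦∧⟧-* false b x = refl

∑ : {A : Set} → List A → (A → ℕ) → ℕ
∑ []       f = 0
∑ (x ∷ xs) f = f x + ∑ xs f

infix 5 ∑
syntax ∑ xs (λ x → e) = ∑[ x ∈ xs ] e

∑-cong : (xs : List A) {f g : A → ℕ} → f ≗ g → ∑ xs f ≡ ∑ xs g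
∑-cong []       f≗g = refl
∑-cong (x ∷ xs) f≗g = cong₂ _+_ (f≗g x) (∑-cong xs f≗g)

∑-++ : (xs ys : List A) (f : A → ℕ) → ∑ (xs ++ ys) f ≡ ∑ xs f + ∑ ys f
∑-++ []       ys f = refl
∑-++ (x ∷ xs) ys f = trans (cong (f x +_) (∑-++ xs ys f)) (sym (+-assoc (f x) _ _))

∑-*ˡ : (c : ℕ) (xs : List A) (f : A → ℕ) → ∑[ x ∈ xs ] c * f x ≡ c * ∑ xs f
∑-*ˡ c []       f = sym (*-zeroʳ c)
∑-*ˡ c (x ∷ xs) f = trans (cong (c * f x +_) (∑-*ˡ c xs f)) (sym (*-distribˡ-+ c (f x) _))

∑-distrib-+ : (xs : List A) (f g : A → ℕ) → ∑[ x ∈ xs ] (f x + g x) ≡ ∑ xs f + ∑ xs g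
∑-distrib-+ []       f g = refl
∑-distrib-+ (x ∷ xs) f g =
  trans (cong (f x + g x +_) (∑-distrib-+ xs f g)) (+-interchange (f x) (g x) (∑ xs f) (∑ xs g))

∑-const : (xs : List A) (c : ℕ) → ∑[ x ∈ xs ] c ≡ length xs * c
∑-const []       c = refl
∑-const (x ∷ xs) c = cong (c +_) (∑-const xs c)

∑-filterᵇ : (p : A → Bool) (xs : List A) (f : A → ℕ) →
  ∑ (filterᵇ p xs) f ≡ ∑[ x ∈ xs ] ⟦ p x ⟧ * f x
∑-filterᵇ p []       f = refl
∑-filterᵇ p (x ∷ xs) f with p x
... | true  = cong₂ _+_ (sym (+-identityʳ (f x))) (∑-filterᵇ p xs f)
... | false = ∑-filterᵇ p xs f

length≡∑1 : (xs : List A) → length xs ≡ ∑[ x ∈ xs ] 1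
length≡∑1 []       = refl
length≡∑1 (x ∷ xs) = cong suc (length≡∑1 xs)

length-filterᵇ : (p : A → Bool) (xs : List A) → length (filterᵇ p xs) ≡ ∑[ x ∈ xs ] ⟦ p x ⟧
length-filterᵇ p xs = trans (length≡∑1 (filterᵇ p xs))
  (trans (∑-filterᵇ p xs (λ _ → 1)) (∑-cong xs (λ x → *-identityʳ ⟦ p x ⟧)))

∑-map : (g : A → B) (xs : List A) (f : B → ℕ) → ∑ (map g xs) f ≡ ∑ xs (f ∘ g)
∑-map g []       f = refl
∑-map g (x ∷ xs) f = cong (f (g x) +_) (∑-map g xs f)

∑-concatMap : (g : A → List B) (xs : List A) (f : B → ℕ) →
  ∑ (concatMap g xs) f ≡ ∑[ x ∈ xs ] ∑ (g x) f
∑-concatMap g []       f = refl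
∑-concatMap g (x ∷ xs) f =
  trans (∑-++ (g x) (concatMap g xs) f) (cong (∑ (g x) f +_) (∑-concatMap g xs f))

∑-comm : (xs : List A) (ys : List B) (f : A → B → ℕ) →
  ∑[ x ∈ xs ] ∑[ y ∈ ys ] f x y ≡ ∑[ y ∈ ys ] ∑[ x ∈ xs ] f x y
∑-comm []       ys f = sym (trans (∑-const ys 0) (*-zeroʳ (length ys)))
∑-comm (x ∷ xs) ys f = trans (cong (∑ ys (f x) +_) (∑-comm xs ys f))
                               (sym (∑-distrib-+ ys (f x) (λ y → ∑[ x ∈ xs ] f x y)))

allFin-suc : (n : ℕ) → allFin (suc n) ≡ zero ∷ map suc (allFin n)
allFin-suc n = cong (zero ∷_) (sym (map-tabulate id suc))

∑-allFin-suc : (n : ℕ) (f : Fin (suc n) → ℕ) → ∑ (allFin (suc n)) f ≡ f zero + (∑[ i ∈ allFin n ] f (suc i))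
∑-allFin-suc n f = trans (cong (λ is → ∑ is f) (allFin-suc n)) (cong (f zero +_) (∑-map suc (allFin n) f))

∑-allFin-const : (n c : ℕ) → ∑[ i ∈ allFin n ] c ≡ n * c
∑-allFin-const n c = trans (∑-const (allFin n) c) (cong (_* c) (length-tabulate {n = n} id))

allᵇ-cong : (xs : List A) {p q : A → Bool} → p ≗ q → allᵇ p xs ≡ allᵇ q xs
allᵇ-cong []       p≗q = refl
allᵇ-cong (x ∷ xs) p≗q = cong₂ _∧_ (p≗q x) (allᵇ-cong xs p≗q)

allᵇ-∧ : (xs : List A) (p q : A → Bool) → allᵇ (λ x → p x ∧ q x) xs ≡ allᵇ p xs ∧ allᵇ q xs
allᵇ-∧ []       p q = refl
allᵇ-∧ (x ∷ xs) p q = trans (cong ((p x ∧ q x) ∧_) (allᵇ-∧ xs p q)) (∧-interchange (p x) (q x) _ _)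

allᵇ-map : (g : A → B) (xs : List A) (p : B → Bool) → allᵇ p (map g xs) ≡ allᵇ (p ∘ g) xs
allᵇ-map g []       p = refl
allᵇ-map g (x ∷ xs) p = cong (p (g x) ∧_) (allᵇ-map g xs p)

allᵇ-allFin-suc : (n : ℕ) (p : Fin (suc n) → Bool) →
  allᵇ p (allFin (suc n)) ≡ p zero ∧ allᵇ (p ∘ suc) (allFin n)
allᵇ-allFin-suc n p = trans (cong (allᵇ p) (allFin-suc n)) (cong (p zero ∧_) (allᵇ-map suc (allFin n) p))

⌊⌋-⇔ : {P Q : Set} → P ⇔ Q → (p? : Dec P) (q? : Dec Q) → ⌊ p? ⌋ ≡ ⌊ q? ⌋
⌊⌋-⇔ P⇔Q p? q? = trans (isYes≗does p?) (trans (does-⇔ P⇔Q p? q?) (sym (isYes≗does q?)))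

≟-suc : {n : ℕ} (a b : Fin n) → ⌊ suc a ≟ suc b ⌋ ≡ ⌊ a ≟ b ⌋
≟-suc a b = ⌊⌋-⇔ (mk⇔ suc-injective (cong suc)) (suc a ≟ suc b) (a ≟ b)

≟-sym : {n : ℕ} (a b : Fin n) → ⌊ a ≟ b ⌋ ≡ ⌊ b ≟ a ⌋
≟-sym a b = ⌊⌋-⇔ (mk⇔ sym sym) (a ≟ b) (b ≟ a)

≟-punchIn : {n : ℕ} (i : Fin (suc n)) (a b : Fin n) → ⌊ punchIn i a ≟ punchIn i b ⌋ ≡ ⌊ a ≟ b ⌋
≟-punchIn i a b = ⌊⌋-⇔ (mk⇔ (punchIn-injective i a b) (cong (punchIn i))) (punchIn i a ≟ punchIn i b) (a ≟ b)

-- Agrees definitionally with isInjᵇ on endomaps, but allows any codomain.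
injectiveᵇ : {n k : ℕ} → (Fin n → Fin k) → Bool
injectiveᵇ {n} f = allᵇ (λ i → allᵇ (λ j → not ⌊ f i ≟ f j ⌋ ∨ ⌊ i ≟ j ⌋) (allFin n)) (allFin n)

avoidsᵇ : {n k : ℕ} → (Fin n → Fin k) → Fin k → Bool
avoidsᵇ {n} f i = allᵇ (λ p → not ⌊ f p ≟ i ⌋) (allFin n)

avoidsᵇ-∷ : {n k : ℕ} (j : Fin k) (f : Fin n → Fin k) (i : Fin k) →
  avoidsᵇ (j ∷ᶠ f) i ≡ avoidsᵇ f i ∧ not ⌊ j ≟ i ⌋
avoidsᵇ-∷ {n} j f i =
  trans (allᵇ-allFin-suc n λ p → not ⌊ (j ∷ᶠ f) p ≟ i ⌋) (∧-comm (not ⌊ j ≟ i ⌋) (avoidsᵇ f i))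

injectiveᵇ-cong : {n k : ℕ} {f g : Fin n → Fin k} → f ≗ g → injectiveᵇ f ≡ injectiveᵇ g
injectiveᵇ-cong {n} f≗g = allᵇ-cong (allFin n) λ i → allᵇ-cong (allFin n) λ j →
  cong₂ (λ a b → not ⌊ a ≟ b ⌋ ∨ ⌊ i ≟ j ⌋) (f≗g i) (f≗g j)

injectiveᵇ-punchIn : {n k : ℕ} (i : Fin (suc k)) (g : Fin n → Fin k) →
  injectiveᵇ (punchIn i ∘ g) ≡ injectiveᵇ g
injectiveᵇ-punchIn {n} i g = allᵇ-cong (allFin n) λ a → allᵇ-cong (allFin n) λ b →
  cong (λ e → not e ∨ ⌊ a ≟ b ⌋) (≟-punchIn i (g a) (g b))

injectiveᵇ-∷ : {n k : ℕ} (i : Fin k) (f : Fin n → Fin k) →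
  injectiveᵇ (i ∷ᶠ f) ≡ avoidsᵇ f i ∧ injectiveᵇ f
injectiveᵇ-∷ {n} {k} i f = begin
    injectiveᵇ (i ∷ᶠ f)
  ≡⟨ allᵇ-allFin-suc n row ⟩
    row zero ∧ allᵇ (row ∘ suc) (allFin n)
  ≡⟨ cong₂ _∧_ row-zero (trans (allᵇ-cong (allFin n) row-suc) (allᵇ-∧ (allFin n) _ _)) ⟩
    avoidsᵇ f i ∧ (avoidsᵇ f i ∧ injectiveᵇ f)
  ≡⟨ sym (∧-assoc (avoidsᵇ f i) _ _) ⟩
    (avoidsᵇ f i ∧ avoidsᵇ f i) ∧ injectiveᵇ f
  ≡⟨ cong (_∧ injectiveᵇ f) (∧-idem (avoidsᵇ f i)) ⟩
    avoidsᵇ f i ∧ injectiveᵇ f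
  ∎
  where
  open ≡-Reasoning
  g : Fin (suc n) → Fin k
  g = i ∷ᶠ f
  row : Fin (suc n) → Bool
  row p = allᵇ (λ q → not ⌊ g p ≟ g q ⌋ ∨ ⌊ p ≟ q ⌋) (allFin (suc n))
  row-zero : row zero ≡ avoidsᵇ f i
  row-zero = begin
      row zero
    ≡⟨ allᵇ-allFin-suc n _ ⟩
      (not ⌊ i ≟ i ⌋ ∨ true) ∧ allᵇ (λ q → not ⌊ i ≟ f q ⌋ ∨ false) (allFin n)
    ≡⟨ cong₂ _∧_ (∨-zeroʳ (not ⌊ i ≟ i ⌋))
             (allᵇ-cong (allFin n) λ q → trans (∨-identityʳ _) (cong not (≟-sym i (f q)))) ⟩
      avoidsᵇ f i
    ∎
  row-suc : ∀ p → row (suc p) ≡ not ⌊ f p ≟ i ⌋ ∧ allᵇ (λ q → not ⌊ f p ≟ f q ⌋ ∨ ⌊ p ≟ q ⌋) (allFin n)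
  row-suc p = trans (allᵇ-allFin-suc n _)
    (cong₂ _∧_ (∨-identityʳ _) (allᵇ-cong (allFin n) λ q → cong (not ⌊ f p ≟ f q ⌋ ∨_) (≟-suc p q)))

Congruent : {A B C : Set} → ((A → B) → C) → Set
Congruent H = ∀ {f g} → f ≗ g → H f ≡ H g

∷-cong : {n : ℕ} (a : A) {f g : Fin n → A} → f ≗ g → (a ∷ᶠ f) ≗ (a ∷ᶠ g)
∷-cong a f≗g zero    = refl
∷-cong a f≗g (suc p) = f≗g p

∷-punchIn : {n k : ℕ} (i : Fin (suc k)) (j : Fin k) (g : Fin n → Fin k) →
  (punchIn i j ∷ᶠ punchIn i ∘ g) ≗ punchIn i ∘ (j ∷ᶠ g)
∷-punchIn i j g zero    = refl
∷-punchIn i j g (suc p) = refl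

∑-allFuns-suc : (n k : ℕ) (G : (Fin (suc n) → Fin k) → ℕ) →
  ∑ (allFuns (suc n) k) G ≡ ∑[ f ∈ allFuns n k ] ∑[ a ∈ allFin k ] G (a ∷ᶠ f)
∑-allFuns-suc n k G = trans (∑-concatMap _ (allFuns n k) G)
  (∑-cong (allFuns n k) λ f → ∑-map (_∷ᶠ f) (allFin k) G)

∑-allFin-punchIn : (k : ℕ) (i : Fin (suc k)) (K : Fin (suc k) → ℕ) →
  ∑[ j ∈ allFin (suc k) ] ⟦ not ⌊ j ≟ i ⌋ ⟧ * K j ≡ ∑[ j ∈ allFin k ] K (punchIn i j)
∑-allFin-punchIn k zero K =
  trans (∑-allFin-suc k λ j → ⟦ not ⌊ j ≟ zero ⌋ ⟧ * K j) (∑-cong (allFin k) λ j → +-identityʳ (K (suc j)))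
∑-allFin-punchIn (suc k) (suc i) K = begin
    ∑[ j ∈ allFin (suc (suc k)) ] ⟦ not ⌊ j ≟ suc i ⌋ ⟧ * K j
  ≡⟨ ∑-allFin-suc (suc k) (λ j → ⟦ not ⌊ j ≟ suc i ⌋ ⟧ * K j) ⟩
    K zero + 0 + (∑[ j ∈ allFin (suc k) ] ⟦ not ⌊ suc j ≟ suc i ⌋ ⟧ * K (suc j))
  ≡⟨ cong₂ _+_ (+-identityʳ (K zero))
       (trans (∑-cong (allFin (suc k)) λ j → cong (λ e → ⟦ not e ⟧ * K (suc j)) (≟-suc j i))
              (∑-allFin-punchIn k i (K ∘ suc))) ⟩
    K zero + (∑[ j ∈ allFin k ] K (suc (punchIn i j)))
  ≡⟨ sym (∑-allFin-suc k (K ∘ punchIn (suc i))) ⟩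
    ∑[ j ∈ allFin (suc k) ] K (punchIn (suc i) j)
  ∎
  where open ≡-Reasoning

∑-avoiding : (n k : ℕ) (i : Fin (suc k)) (H : (Fin n → Fin (suc k)) → ℕ) → Congruent H →
  ∑[ f ∈ allFuns n (suc k) ] ⟦ avoidsᵇ f i ⟧ * H f ≡ ∑[ g ∈ allFuns n k ] H (punchIn i ∘ g)
∑-avoiding zero    k i H H-cong = cong (_+ 0) (trans (+-identityʳ _) (H-cong λ ()))
∑-avoiding (suc n) k i H H-cong = begin
    ∑[ f ∈ allFuns (suc n) (suc k) ] ⟦ avoidsᵇ f i ⟧ * H f
  ≡⟨ ∑-allFuns-suc n (suc k) _ ⟩
    ∑[ f ∈ allFuns n (suc k) ] ∑[ j ∈ allFin (suc k) ] ⟦ avoidsᵇ (j ∷ᶠ f) i ⟧ * H (j ∷ᶠ f)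
  ≡⟨ ∑-cong (allFuns n (suc k)) split-head ⟩
    ∑[ f ∈ allFuns n (suc k) ] ⟦ avoidsᵇ f i ⟧ * (∑[ j ∈ allFin (suc k) ] ⟦ not ⌊ j ≟ i ⌋ ⟧ * H (j ∷ᶠ f))
  ≡⟨ ∑-cong (allFuns n (suc k)) (λ f → cong (⟦ avoidsᵇ f i ⟧ *_) (∑-allFin-punchIn k i λ j → H (j ∷ᶠ f))) ⟩
    ∑[ f ∈ allFuns n (suc k) ] ⟦ avoidsᵇ f i ⟧ * (∑[ j ∈ allFin k ] H (punchIn i j ∷ᶠ f))
  ≡⟨ ∑-avoiding n k i _ (λ f≗g → ∑-cong (allFin k) λ j → H-cong (∷-cong (punchIn i j) f≗g)) ⟩
    ∑[ g ∈ allFuns n k ] ∑[ j ∈ allFin k ] H (punchIn i j ∷ᶠ punchIn i ∘ g)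
  ≡⟨ ∑-cong (allFuns n k) (λ g → ∑-cong (allFin k) λ j → H-cong (∷-punchIn i j g)) ⟩
    ∑[ g ∈ allFuns n k ] ∑[ j ∈ allFin k ] H (punchIn i ∘ (j ∷ᶠ g))
  ≡⟨ sym (∑-allFuns-suc n k _) ⟩
    ∑[ g ∈ allFuns (suc n) k ] H (punchIn i ∘ g)
  ∎
  where
  open ≡-Reasoning
  split-head : ∀ f → ∑[ j ∈ allFin (suc k) ] ⟦ avoidsᵇ (j ∷ᶠ f) i ⟧ * H (j ∷ᶠ f)
                   ≡ ⟦ avoidsᵇ f i ⟧ * (∑[ j ∈ allFin (suc k) ] ⟦ not ⌊ j ≟ i ⌋ ⟧ * H (j ∷ᶠ f))
  split-head f = trans
    (∑-cong (allFin (suc k)) λ j →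
       trans (cong (λ b → ⟦ b ⟧ * H (j ∷ᶠ f)) (avoidsᵇ-∷ j f i)) (⟦∧⟧-* (avoidsᵇ f i) _ _))
    (∑-*ˡ ⟦ avoidsᵇ f i ⟧ (allFin (suc k)) _)

∑-perms : (n : ℕ) (H : (Fin n → Fin n) → ℕ) →
  ∑ (perms n) H ≡ ∑[ ω ∈ allFuns n n ] ⟦ injectiveᵇ ω ⟧ * H ω
∑-perms n = ∑-filterᵇ isInjᵇ (allFuns n n)

∑-perms-suc : (n : ℕ) (H : (Fin (suc n) → Fin (suc n)) → ℕ) → Congruent H →
  ∑ (perms (suc n)) H ≡ ∑[ i ∈ allFin (suc n) ] ∑[ σ ∈ perms n ] H (i ∷ᶠ punchIn i ∘ σ)
∑-perms-suc n H H-cong = begin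
    ∑ (perms (suc n)) H
  ≡⟨ ∑-perms (suc n) H ⟩
    ∑[ ω ∈ allFuns (suc n) (suc n) ] ⟦ injectiveᵇ ω ⟧ * H ω
  ≡⟨ ∑-allFuns-suc n (suc n) _ ⟩
    ∑[ f ∈ allFuns n (suc n) ] ∑[ i ∈ allFin (suc n) ] ⟦ injectiveᵇ (i ∷ᶠ f) ⟧ * H (i ∷ᶠ f)
  ≡⟨ ∑-cong (allFuns n (suc n)) (λ f → ∑-cong (allFin (suc n)) λ i →
       trans (cong (λ b → ⟦ b ⟧ * H (i ∷ᶠ f)) (injectiveᵇ-∷ i f)) (⟦∧⟧-* (avoidsᵇ f i) _ _)) ⟩
    ∑[ f ∈ allFuns n (suc n) ] ∑[ i ∈ allFin (suc n) ] ⟦ avoidsᵇ f i ⟧ * (⟦ injectiveᵇ f ⟧ * H (i ∷ᶠ f))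
  ≡⟨ ∑-comm (allFuns n (suc n)) (allFin (suc n)) _ ⟩
    ∑[ i ∈ allFin (suc n) ] ∑[ f ∈ allFuns n (suc n) ] ⟦ avoidsᵇ f i ⟧ * (⟦ injectiveᵇ f ⟧ * H (i ∷ᶠ f))
  ≡⟨ ∑-cong (allFin (suc n)) (λ i → ∑-avoiding n n i _ λ f≗g →
       cong₂ _*_ (cong ⟦_⟧ (injectiveᵇ-cong f≗g)) (H-cong (∷-cong i f≗g))) ⟩
    ∑[ i ∈ allFin (suc n) ] ∑[ g ∈ allFuns n n ] ⟦ injectiveᵇ (punchIn i ∘ g) ⟧ * H (i ∷ᶠ punchIn i ∘ g)
  ≡⟨ ∑-cong (allFin (suc n)) (λ i → trans
       (∑-cong (allFuns n n) λ g → cong (λ b → ⟦ b ⟧ * H (i ∷ᶠ punchIn i ∘ g)) (injectiveᵇ-punchIn i g))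
       (sym (∑-perms n λ σ → H (i ∷ᶠ punchIn i ∘ σ)))) ⟩
    ∑[ i ∈ allFin (suc n) ] ∑[ σ ∈ perms n ] H (i ∷ᶠ punchIn i ∘ σ)
  ∎
  where open ≡-Reasoning

∑-colPerms : (n r : ℕ) (G : ColPerm n r → ℕ) →
  ∑ (colPerms n r) G ≡ ∑[ ω ∈ perms n ] ∑[ τ ∈ allFuns n r ] G (ω , τ)
∑-colPerms n r G = trans (∑-concatMap _ (perms n) G)
  (∑-cong (perms n) λ ω → ∑-map (ω ,_) (allFuns n r) G)

∑-colPerms-suc : (n r : ℕ) (G : ColPerm (suc n) r → ℕ) (F : ColPerm n r → ℕ) →
  (∀ τ → Congruent (λ ω → G (ω , τ))) →
  (∀ i c σ τ → G (i ∷ᶠ punchIn i ∘ σ , c ∷ᶠ τ) ≡ F (σ , τ)) →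
  ∑ (colPerms (suc n) r) G ≡ suc n * (r * ∑ (colPerms n r) F)
∑-colPerms-suc n r G F G-cong G≡F = begin
    ∑ (colPerms (suc n) r) G
  ≡⟨ ∑-colPerms (suc n) r G ⟩
    ∑[ ω ∈ perms (suc n) ] ∑[ τ ∈ allFuns (suc n) r ] G (ω , τ)
  ≡⟨ ∑-perms-suc n _ (λ ω≗ω′ → ∑-cong (allFuns (suc n) r) λ τ → G-cong τ ω≗ω′) ⟩
    ∑[ i ∈ allFin (suc n) ] ∑[ σ ∈ perms n ] ∑[ τ ∈ allFuns (suc n) r ] G (i ∷ᶠ punchIn i ∘ σ , τ)
  ≡⟨ ∑-cong (allFin (suc n)) (λ i → ∑-cong (perms n) λ σ → trans (∑-allFuns-suc n r _)
       (∑-cong (allFuns n r) λ τ → trans (∑-cong (allFin r) λ c → G≡F i c σ τ) (∑-allFin-const r _))) ⟩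
    ∑[ i ∈ allFin (suc n) ] ∑[ σ ∈ perms n ] ∑[ τ ∈ allFuns n r ] r * F (σ , τ)
  ≡⟨ ∑-cong (allFin (suc n)) (λ i → begin
       ∑[ σ ∈ perms n ] ∑[ τ ∈ allFuns n r ] r * F (σ , τ)    ≡⟨ ∑-cong (perms n) (λ σ → ∑-*ˡ r (allFuns n r) _) ⟩
       ∑[ σ ∈ perms n ] r * (∑[ τ ∈ allFuns n r ] F (σ , τ))  ≡⟨ ∑-*ˡ r (perms n) _ ⟩
       r * (∑[ σ ∈ perms n ] ∑[ τ ∈ allFuns n r ] F (σ , τ))  ≡⟨ cong (r *_) (∑-colPerms n r F) ⟨
       r * ∑ (colPerms n r) F                                  ∎) ⟩
    ∑[ i ∈ allFin (suc n) ] r * ∑ (colPerms n r) F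
  ≡⟨ ∑-allFin-const (suc n) _ ⟩
    suc n * (r * ∑ (colPerms n r) F)
  ∎
  where open ≡-Reasoning

-- (m + n)!/n! · r^m, the number of possible first m letters of a coloured permutation of [m + n].
prefixCount : (n r m : ℕ) → ℕ
prefixCount n r zero    = 1
prefixCount n r (suc m) = suc (m + n) * (r * prefixCount n r m)

∑-colPerms-+ : (n r : ℕ) (G : (m : ℕ) → ColPerm (m + n) r → ℕ) →
  (∀ m τ → Congruent (λ ω → G m (ω , τ))) →
  (∀ m i c σ τ → G (suc m) (i ∷ᶠ punchIn i ∘ σ , c ∷ᶠ τ) ≡ G m (σ , τ)) →
  ∀ m → ∑ (colPerms (m + n) r) (G m) ≡ prefixCount n r m * ∑ (colPerms n r) (G 0)
∑-colPerms-+ n r G G-cong G-shift zero    = sym (*-identityˡ _)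
∑-colPerms-+ n r G G-cong G-shift (suc m) = begin
    ∑ (colPerms (suc m + n) r) (G (suc m))
  ≡⟨ ∑-colPerms-suc (m + n) r (G (suc m)) (G m) (G-cong (suc m)) (G-shift m) ⟩
    suc (m + n) * (r * ∑ (colPerms (m + n) r) (G m))
  ≡⟨ cong (λ s → suc (m + n) * (r * s)) (∑-colPerms-+ n r G G-cong G-shift m) ⟩
    suc (m + n) * (r * (prefixCount n r m * S))
  ≡⟨ cong (suc (m + n) *_) (sym (*-assoc r (prefixCount n r m) S)) ⟩
    suc (m + n) * (r * prefixCount n r m * S)
  ≡⟨ sym (*-assoc (suc (m + n)) (r * prefixCount n r m) S) ⟩
    prefixCount n r (suc m) * S
  ∎
  where
  open ≡-Reasoning
  S : ℕ
  S = ∑ (colPerms n r) (G 0)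

-- The action of punchIn on values; it also sends the sentinel value N to N + 1.

punchInℕ : ℕ → ℕ → ℕ
punchInℕ zero    x       = suc x
punchInℕ (suc t) zero    = zero
punchInℕ (suc t) (suc x) = suc (punchInℕ t x)

toℕ-punchIn : {n : ℕ} (i : Fin (suc n)) (a : Fin n) → toℕ (punchIn i a) ≡ punchInℕ (toℕ i) (toℕ a)
toℕ-punchIn zero    a       = refl
toℕ-punchIn (suc i) zero    = refl
toℕ-punchIn (suc i) (suc a) = cong suc (toℕ-punchIn i a)

punchInℕ-≥ : {t x : ℕ} → t ≤ x → punchInℕ t x ≡ suc x
punchInℕ-≥ z≤n       = refl
punchInℕ-≥ (s≤s t≤x) = cong suc (punchInℕ-≥ t≤x)

punchInℕ-<ᵇ : (t x y : ℕ) → (punchInℕ t x <ᵇ punchInℕ t y) ≡ (x <ᵇ y)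
punchInℕ-<ᵇ zero    x       y       = refl
punchInℕ-<ᵇ (suc t) zero    zero    = refl
punchInℕ-<ᵇ (suc t) zero    (suc y) = refl
punchInℕ-<ᵇ (suc t) (suc x) zero    = refl
punchInℕ-<ᵇ (suc t) (suc x) (suc y) = punchInℕ-<ᵇ t x y


valAt-< : {n : ℕ} (ω : Fin n → Fin n) {p : ℕ} (p<n : p < n) → valAt ω p ≡ toℕ (ω (fromℕ< p<n))
valAt-< {n} ω {p} p<n with p <? n
... | yes _   = refl
... | no  p≮n = ⊥-elim (p≮n p<n)

valAt-≮ : {n : ℕ} (ω : Fin n → Fin n) {p : ℕ} → ¬ p < n → valAt ω p ≡ n
valAt-≮ {n} ω {p} p≮n with p <? n
... | yes p<n = ⊥-elim (p≮n p<n)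
... | no  _   = refl

valAt-cong : {n : ℕ} {ω ω′ : Fin n → Fin n} → ω ≗ ω′ → ∀ p → valAt ω p ≡ valAt ω′ p
valAt-cong {n} ω≗ω′ p with p <? n
... | yes _ = cong toℕ (ω≗ω′ _)
... | no  _ = refl

colAt-< : {n r : ℕ} (τ : Fin n → Fin r) {p : ℕ} (p<n : p < n) → colAt τ p ≡ toℕ (τ (fromℕ< p<n))
colAt-< {n} τ {p} p<n with p <? n
... | yes _   = refl
... | no  p≮n = ⊥-elim (p≮n p<n)

colAt-≮ : {n r : ℕ} (τ : Fin n → Fin r) {p : ℕ} → ¬ p < n → colAt τ p ≡ 0
colAt-≮ {n} τ {p} p≮n with p <? n
... | yes p<n = ⊥-elim (p≮n p<n)
... | no  _   = refl

valAt-∷-punchIn : {n : ℕ} (i : Fin (suc n)) (σ : Fin n → Fin n) (q : ℕ) →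
  valAt (i ∷ᶠ punchIn i ∘ σ) (suc q) ≡ punchInℕ (toℕ i) (valAt σ q)
valAt-∷-punchIn {n} i σ q = case q <? n of λ where
    (yes q<n) → begin
      valAt (i ∷ᶠ punchIn i ∘ σ) (suc q)     ≡⟨ valAt-< (i ∷ᶠ punchIn i ∘ σ) (s≤s q<n) ⟩
      toℕ (punchIn i (σ (fromℕ< q<n)))        ≡⟨ toℕ-punchIn i (σ (fromℕ< q<n)) ⟩
      punchInℕ (toℕ i) (toℕ (σ (fromℕ< q<n))) ≡⟨ cong (punchInℕ (toℕ i)) (valAt-< σ q<n) ⟨
      punchInℕ (toℕ i) (valAt σ q)            ∎
    (no q≮n) → begin
      valAt (i ∷ᶠ punchIn i ∘ σ) (suc q)     ≡⟨ valAt-≮ (i ∷ᶠ punchIn i ∘ σ) (q≮n ∘ ≤-pred) ⟩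
      suc n                                   ≡⟨ punchInℕ-≥ (≤-pred (toℕ<n i)) ⟨
      punchInℕ (toℕ i) n                      ≡⟨ cong (punchInℕ (toℕ i)) (valAt-≮ σ q≮n) ⟨
      punchInℕ (toℕ i) (valAt σ q)            ∎
  where open ≡-Reasoning

colAt-∷ : {n r : ℕ} (c : Fin r) (τ : Fin n → Fin r) (q : ℕ) → colAt (c ∷ᶠ τ) (suc q) ≡ colAt τ q
colAt-∷ {n} c τ q = case q <? n of λ where
  (yes q<n) → trans (colAt-< (c ∷ᶠ τ) (s≤s q<n)) (sym (colAt-< τ q<n))
  (no  q≮n) → trans (colAt-≮ (c ∷ᶠ τ) (q≮n ∘ ≤-pred)) (sym (colAt-≮ τ q≮n))

isDescentᵇ-cong : {n r : ℕ} {ω ω′ : Fin n → Fin n} (τ : Fin n → Fin r) → ω ≗ ω′ → ∀ p →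
  isDescentᵇ (ω , τ) p ≡ isDescentᵇ (ω′ , τ) p
isDescentᵇ-cong τ ω≗ω′ p rewrite valAt-cong ω≗ω′ p | valAt-cong ω≗ω′ (suc p) = refl

isDescentᵇ-∷-punchIn : {n r : ℕ} (i : Fin (suc n)) (c : Fin r) (σ : Fin n → Fin n) (τ : Fin n → Fin r) →
  ∀ p → isDescentᵇ (i ∷ᶠ punchIn i ∘ σ , c ∷ᶠ τ) (suc p) ≡ isDescentᵇ (σ , τ) p
isDescentᵇ-∷-punchIn i c σ τ p
  rewrite colAt-∷ c τ p | colAt-∷ c τ (suc p)
        | valAt-∷-punchIn i σ p | valAt-∷-punchIn i σ (suc p)
        | punchInℕ-<ᵇ (toℕ i) (valAt σ (suc p)) (valAt σ p) = refl

-- The event X_{m+1} ⋯ X_{m+n}, in 0-based positions.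
descentBlock : (m n : ℕ) {N r : ℕ} → ColPerm N r → Bool
descentBlock m n x = allᵇ (isDescentᵇ x) (map (m +_) (upTo n))

descentBlock-cong : (m n : ℕ) {N r : ℕ} {ω ω′ : Fin N → Fin N} (τ : Fin N → Fin r) → ω ≗ ω′ →
  descentBlock m n (ω , τ) ≡ descentBlock m n (ω′ , τ)
descentBlock-cong m n τ ω≗ω′ = allᵇ-cong (map (m +_) (upTo n)) (isDescentᵇ-cong τ ω≗ω′)

descentBlock-∷-punchIn : (m n : ℕ) {N r : ℕ} (i : Fin (suc N)) (c : Fin r) (σ : Fin N → Fin N) (τ : Fin N → Fin r) →
  descentBlock (suc m) n (i ∷ᶠ punchIn i ∘ σ , c ∷ᶠ τ) ≡ descentBlock m n (σ , τ)
descentBlock-∷-punchIn m n i c σ τ = begin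
    allᵇ (isDescentᵇ (i ∷ᶠ punchIn i ∘ σ , c ∷ᶠ τ)) (map (suc m +_) (upTo n))
  ≡⟨ allᵇ-map (suc m +_) (upTo n) _ ⟩
    allᵇ (λ j → isDescentᵇ (i ∷ᶠ punchIn i ∘ σ , c ∷ᶠ τ) (suc (m + j))) (upTo n)
  ≡⟨ allᵇ-cong (upTo n) (λ j → isDescentᵇ-∷-punchIn i c σ τ (m + j)) ⟩
    allᵇ (λ j → isDescentᵇ (σ , τ) (m + j)) (upTo n)
  ≡⟨ allᵇ-map (m +_) (upTo n) _ ⟨
    allᵇ (isDescentᵇ (σ , τ)) (map (m +_) (upTo n))
  ∎
  where open ≡-Reasoning

countAllDesc-+ : (m n r : ℕ) →
  countAllDesc (m + n) r (map (m +_) (upTo n)) ≡ prefixCount n r m * countAllDesc n r (upTo n)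
countAllDesc-+ m n r = begin
    countAllDesc (m + n) r (map (m +_) (upTo n))
  ≡⟨ length-filterᵇ (descentBlock m n) (colPerms (m + n) r) ⟩
    ∑[ x ∈ colPerms (m + n) r ] ⟦ descentBlock m n x ⟧
  ≡⟨ ∑-colPerms-+ n r (λ k x → ⟦ descentBlock k n x ⟧)
       (λ k τ ω≗ω′ → cong ⟦_⟧ (descentBlock-cong k n τ ω≗ω′))
       (λ k i c σ τ → cong ⟦_⟧ (descentBlock-∷-punchIn k n i c σ τ)) m ⟩
    prefixCount n r m * (∑[ x ∈ colPerms n r ] ⟦ descentBlock 0 n x ⟧)
  ≡⟨ cong (prefixCount n r m *_) (∑-cong (colPerms n r) λ x → cong ⟦_⟧ (allᵇ-map (0 +_) (upTo n) _)) ⟩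
    prefixCount n r m * (∑[ x ∈ colPerms n r ] ⟦ allᵇ (isDescentᵇ x) (upTo n) ⟧)
  ≡⟨ cong (prefixCount n r m *_) (length-filterᵇ _ (colPerms n r)) ⟨
    prefixCount n r m * countAllDesc n r (upTo n)
  ∎
  where open ≡-Reasoning

size-+ : (m n r : ℕ) → size (m + n) r ≡ prefixCount n r m * size n r
size-+ m n r = begin
    size (m + n) r
  ≡⟨ length≡∑1 (colPerms (m + n) r) ⟩
    ∑[ x ∈ colPerms (m + n) r ] 1
  ≡⟨ ∑-colPerms-+ n r (λ _ _ → 1) (λ _ _ _ → refl) (λ _ _ _ _ _ → refl) m ⟩
    prefixCount n r m * (∑[ x ∈ colPerms n r ] 1)
  ≡⟨ cong (prefixCount n r m *_) (length≡∑1 (colPerms n r)) ⟨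
    prefixCount n r m * size n r
  ∎
  where open ≡-Reasoning

corollary3p6 : (m n r : ℕ) → m ≥ 1 → n ≥ 1 → r ≥ 1 →
    countAllDesc n r (upTo n) * size (m + n) r
      ≡ countAllDesc (m + n) r (map (m +_) (upTo n)) * size n r
corollary3p6 m n r _ _ _ = begin
    D * size (m + n) r
  ≡⟨ cong (D *_) (size-+ m n r) ⟩
    D * (K * size n r)
  ≡⟨ *-assoc D K (size n r) ⟨
    D * K * size n r
  ≡⟨ cong (_* size n r) (*-comm D K) ⟩
    K * D * size n r
  ≡⟨ cong (_* size n r) (countAllDesc-+ m n r) ⟨
    countAllDesc (m + n) r (map (m +_) (upTo n)) * size n r
  ∎
  where
  open ≡-Reasoning
  D K : ℕ
  D = countAllDesc n r (upTo n)
  K = prefixCount n r m
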